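{- Let $t,t_1,\dots,t_k$ be closed infinitary lambda trees with $t\,t_1\dots t_k$ of type $\iota$. If $\mathrm{cn}(t;t_1,\dots,t_k)=\mathcal W_1(\mathcal W_2(\dots(\mathcal W_\ell(\mathfrak f(\vec s)))\dots))$ with $\mathcal W_1,\dots,\mathcal W_\ell\in\{\mathcal R,\beta\}$ and $\mathfrak f\in\Sigma'$, then $k+|\{i\mid\mathcal W_i=\mathcal R\}|=|\{i\mid\mathcal W_i=\beta\}|+\mathrm{ar}(\mathfrak f)$.
   Context: $\Sigma'$ is a ranked alphabet (letters $\mathfrak f$ with arities $\mathrm{ar}(\mathfrak f)$); $\mathcal R,\beta$ are two new letters of arity $1$ and $\Sigma=\Sigma'\cup\{\mathcal R,\beta\}$; $\Sigma$-terms are possibly non-well-founded trees labelled by $\Sigma$ respecting arities. Simple types are generated from $\iota$ by $\to$. Infinitary simply-typed lambda trees are coinductively (possibly non-well-founded) type-correct trees built from typed variables $x^\rho$, abstractions $\lambda x^\rho t$, applications $ts$, and constants $\mathfrak f\in\Sigma'$ of type $\iota\to\dots\to\iota\to\iota$ ($\mathrm{ar}(\mathfrak f)$ arguments); closed = no free variables. For closed $t,\vec t$ with $t\vec t:\iota$, the continuous normal form is the $\Sigma$-term defined coinductively by $\mathrm{cn}(rs;\vec t)=\mathcal R(\mathrm{cn}(r;s,\vec t))$, $\mathrm{cn}(\lambda x.r;s,\vec t)=\beta(\mathrm{cn}(r[s/x];\vec t))$, $\mathrm{cn}(\mathfrak f;t_1,\dots,t_n)=\mathfrak f(t_1^\beta,\dots,t_n^\beta)$,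 with $t^\beta=\mathrm{cn}(t;())$. -}

module Defs where

-- Non-well-founded trees are represented in the classical way, as labellings of
-- positions: a tree is a map  List ℕ → Maybe Label  (positions are root-to-node
-- paths of child indices; `nothing` = position not in the tree).

open import Data.Nat using (ℕ; zero; suc; _+_; _<_; _≟_)
open import Data.List using (List; []; _∷_; _++_; [_])
open import Data.Maybe using (Maybe; just; nothing)
open import Data.Product using (Σ; _×_; _,_; ∃)
open import Data.Empty using (⊥)
open import Relation.Nullary using (¬_; yes; no; Dec)
open import Relation.Binary.PropositionalEquality using (_≡_; _≢_; refl; cong₂)
open import Relation.Nullary.Decidable using (map′)
open import Function.Bundles using (_⇔_)

record RankedAlphabet : Set₁ where
  field
    Letter : Set
    ar     : Letter → ℕ
open RankedAlphabet public

infixr 5 _⇒_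
data Ty : Set where
  ι   : Ty
  _⇒_ : Ty → Ty → Ty

⇒-inj₁ : ∀ {a b c d} → a ⇒ b ≡ c ⇒ d → a ≡ c
⇒-inj₁ refl = refl
⇒-inj₂ : ∀ {a b c d} → a ⇒ b ≡ c ⇒ d → b ≡ d
⇒-inj₂ refl = refl

_≟Ty_ : (a b : Ty) → Dec (a ≡ b)
ι ≟Ty ι = yes refl
ι ≟Ty (_ ⇒ _) = no λ ()
(_ ⇒ _) ≟Ty ι = no λ ()
(a ⇒ b) ≟Ty (c ⇒ d) with a ≟Ty c | b ≟Ty d
... | yes refl | yes refl = yes refl
... | no ne | _ = no λ e → ne (⇒-inj₁ e)
... | yes _ | no ne = no λ e → ne (⇒-inj₂ e)

arTy : ℕ → Ty
arTy zero    = ι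
arTy (suc n) = ι ⇒ arTy n

record Var : Set where
  constructor _^_
  field
    name : ℕ
    type : Ty
open Var public

_≟Var_ : (x y : Var) → Dec (x ≡ y)
(m ^ a) ≟Var (n ^ b) with m ≟ n | a ≟Ty b
... | yes refl | yes refl = yes refl
... | no ne | _ = no λ { refl → ne refl }
... | yes _ | no ne = no λ { refl → ne refl }

Pos : Set
Pos = List ℕ

module _ (A : RankedAlphabet) where

  data LLab : Set where
    var   : Var → LLab
    lam   : Var → LLab
    app   : LLab              -- application (children 0 = function, 1 = argument)
    const : Letter A → LLab

  nChildren : LLab → ℕ
  nChildren (var _)   = 0
  nChildren (lam _)   = 1
  nChildren app       = 2
  nChildren (const _) = 0

  RawTm : Set
  RawTm = Pos → Maybe LLab

  child : ∀ {X : Set} → ℕ → (Pos → X) → (Pos → X)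
  child i t p = t (i ∷ p)

  IsTree : ∀ {L : Set} → (L → ℕ) → (Pos → Maybe L) → Set
  IsTree {L} nch t =
    (t [] ≢ nothing) ×
    (∀ p i → (t (p ++ [ i ]) ≢ nothing) ⇔ (Σ L λ l → (t p ≡ just l) × (i < nch l)))

  TypeOK : LLab → Ty → Ty → Ty → Set
  TypeOK (var x)   τ τ₀ τ₁ = τ ≡ type x
  TypeOK (lam x)   τ τ₀ τ₁ = τ ≡ type x ⇒ τ₀
  TypeOK app       τ τ₀ τ₁ = τ₀ ≡ τ₁ ⇒ τ
  TypeOK (const f) τ τ₀ τ₁ = τ ≡ arTy (ar A f)

  record ClosedTm (ρ : Ty) : Set where
    field
      lab    : RawTm
      ty     : Pos → Ty
      tree   : IsTree nChildren lab
      typed  : ∀ p l → lab p ≡ just l →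
               TypeOK l (ty p) (ty (p ++ [ 0 ])) (ty (p ++ [ 1 ]))
      root   : ty [] ≡ ρ
      closed : ∀ p x → lab p ≡ just (var x) →
               Σ Pos λ q → Σ ℕ λ j → Σ Pos λ r →
                 (p ≡ q ++ (j ∷ r)) × (lab q ≡ just (lam x))
  open ClosedTm public

  -- Argument lists t₁ … t_k (closed trees) such that t t₁ … t_k : ι when t : τ.
  infixr 5 _∷ₐ_
  data Args : Ty → Set where
    []ₐ  : Args ι
    _∷ₐ_ : ∀ {σ τ} → ClosedTm σ → Args τ → Args (σ ⇒ τ)

  argsLength : ∀ {τ} → Args τ → ℕ
  argsLength []ₐ       = zero
  argsLength (_ ∷ₐ as) = suc (argsLength as)

  argsRaw : ∀ {τ} → Args τ → List RawTm
  argsRaw []ₐ       = []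
  argsRaw (t ∷ₐ as) = lab t ∷ argsRaw as

  -- r[s/x] for a closed s (so no capture can occur); substitution stops below
  -- a rebinding λx.
  substAt : RawTm → RawTm → Var → Pos → Maybe LLab
  substAt r s x [] with r []
  ... | just (var y) with y ≟Var x
  ...   | yes _ = s []
  ...   | no _  = just (var y)
  substAt r s x [] | l = l
  substAt r s x (i ∷ p) with r []
  ... | just (var y) with y ≟Var x
  ...   | yes _ = s (i ∷ p)
  ...   | no _  = r (i ∷ p)
  substAt r s x (i ∷ p) | just (lam y) with y ≟Var x
  ...   | yes _ = r (i ∷ p)
  ...   | no _  = substAt (child i r) s x p
  substAt r s x (i ∷ p) | _ = substAt (child i r) s x p

  _[_/_] : RawTm → RawTm → Var → RawTm
  (r [ s / x ]) = substAt r s x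

  data SLab : Set where
    ℛ  : SLab
    β  : SLab
    fn : Letter A → SLab

  sArity : SLab → ℕ
  sArity ℛ      = 1
  sArity β      = 1
  sArity (fn f) = ar A f

  STerm : Set
  STerm = Pos → Maybe SLab

  lookupL : List RawTm → ℕ → RawTm
  lookupL []       _       = λ _ → nothing
  lookupL (t ∷ ts) zero    = t
  lookupL (t ∷ ts) (suc i) = lookupL ts i

  -- Continuous normal form cn(t; t⃗), computed position by position:
  --   cn(r s; t⃗)      = ℛ(cn(r; s, t⃗))
  --   cn(λx.r; s, t⃗)  = β(cn(r[s/x]; t⃗))
  --   cn(𝔣; t₁…tₙ)    = 𝔣(cn(t₁;()), …, cn(tₙ;()))
  -- (ill-typed/non-closed cases, which never arise, yield `nothing`).
  cnAt : RawTm → List RawTm → Pos → Maybe SLab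
  cnAt t ts [] with t []
  ... | just app       = just ℛ
  ... | just (lam _)   with ts
  ...   | []    = nothing
  ...   | _ ∷ _ = just β
  cnAt t ts [] | just (const f) = just (fn f)
  cnAt t ts [] | _              = nothing
  cnAt t ts (i ∷ p) with t []
  ... | just app with i
  ...   | zero  = cnAt (child 0 t) (child 1 t ∷ ts) p
  ...   | suc _ = nothing
  cnAt t ts (i ∷ p) | just (lam x) with ts | i
  ...   | s ∷ ts' | zero  = cnAt ((child 0 t) [ s / x ]) ts' p
  ...   | _       | _     = nothing
  cnAt t ts (i ∷ p) | just (const f) = cnAt (lookupL ts i) [] p
  cnAt t ts (i ∷ p) | _ = nothing

  cn : ∀ {τ} → ClosedTm τ → Args τ → STerm
  cn t ts = cnAt (lab t) (argsRaw ts)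

  data W : Set where
    Wℛ Wβ : W

  wLab : W → SLab
  wLab Wℛ = ℛ
  wLab Wβ = β

  -- HasShape u (W₁ ∷ … ∷ W_ℓ) f  :⇔  u = W₁(W₂(…W_ℓ(f(s⃗))…)) for some s⃗
  HasShape : STerm → List W → Letter A → Set
  HasShape u []       f = u [] ≡ just (fn f)
  HasShape u (w ∷ ws) f = (u [] ≡ just (wLab w)) × HasShape (child 0 u) ws f

countℛ : ∀ {A} → List (W A) → ℕ
countℛ []        = zero
countℛ (Wℛ ∷ ws) = suc (countℛ ws)
countℛ (Wβ ∷ ws) = countℛ ws

countβ : ∀ {A} → List (W A) → ℕ
countβ []        = zero
countβ (Wℛ ∷ ws) = countβ ws
countβ (Wβ ∷ ws) = suc (countβ ws)

-- Only typing matters.  Each ℛ moves an argument onto the stack, each β pops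
-- one, and a constant 𝔣 : ι → … → ι → ι is applied to exactly ar 𝔣 arguments
-- since the whole application has type ι.  Along the spine the reducts stay
-- well typed because substituting a closed term of the binder's type
-- preserves typing (with the evident type assignment on the reduct).
module Submission where

open import Defs
open import Data.Nat using (zero; suc; _+_)
open import Data.Nat.Properties using (+-suc; +-identityʳ)
open import Data.List using (List; []; _∷_; _++_; [_]; length)
open import Data.Maybe using (just; nothing)
open import Data.Product using (Σ; ∃; _×_; _,_)
open import Relation.Nullary using (yes; no)
open import Relation.Binary.PropositionalEquality
  using (_≡_; refl; sym; trans; cong; subst; module ≡-Reasoning)

module _ (A : RankedAlphabet) where

  WellTypedAt : RawTm A → (Pos → Ty) → Pos → Set
  WellTypedAt r ty p =
    ∀ l → r p ≡ just l → TypeOK A l (ty p) (ty (p ++ [ 0 ])) (ty (p ++ [ 1 ]))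

  WellTyped : RawTm A → (Pos → Ty) → Set
  WellTyped r ty = ∀ p → WellTypedAt r ty p

  child-wellTyped : ∀ {r ty} i → WellTyped r ty → WellTyped (child A i r) (child A i ty)
  child-wellTyped i wt p = wt (i ∷ p)

  -- TypedArgs ts τ : the stack ts can be typed so that a term of type τ
  -- applied to it has type ι.
  data TypedArgs : List (RawTm A) → Ty → Set where
    []ₜ  : TypedArgs [] ι
    _∷ₜ_ : ∀ {s ts σ τ} → (∃ λ ty → WellTyped s ty × ty [] ≡ σ) →
           TypedArgs ts τ → TypedArgs (s ∷ ts) (σ ⇒ τ)

  typedArgs : ∀ {τ} (ts : Args A τ) → TypedArgs (argsRaw A ts) τ
  typedArgs []ₐ       = []ₜ
  typedArgs (t ∷ₐ ts) = (ty t , typed t , root t) ∷ₜ typedArgs ts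

  length-argsRaw : ∀ {τ} (ts : Args A τ) → length (argsRaw A ts) ≡ argsLength A ts
  length-argsRaw []ₐ       = refl
  length-argsRaw (_ ∷ₐ ts) = cong suc (length-argsRaw ts)

  length-typedArgs-arTy : ∀ {ts} n → TypedArgs ts (arTy n) → length ts ≡ n
  length-typedArgs-arTy zero    []ₜ       = refl
  length-typedArgs-arTy (suc n) (_ ∷ₜ ts) = cong suc (length-typedArgs-arTy n ts)

  -- The type assignment of r[s/x]: positions copied from s get their type in s.
  substTy : RawTm A → (Pos → Ty) → (Pos → Ty) → Var → Pos → Ty
  substTy r tr ts x [] with r []
  ... | just (var y) with y ≟Var x
  ...   | yes _ = ts []
  ...   | no _  = tr []
  substTy r tr ts x [] | _ = tr []
  substTy r tr ts x (i ∷ p) with r []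
  ... | just (var y) with y ≟Var x
  ...   | yes _ = ts (i ∷ p)
  ...   | no _  = tr (i ∷ p)
  substTy r tr ts x (i ∷ p) | just (lam y) with y ≟Var x
  ...   | yes _ = tr (i ∷ p)
  ...   | no _  = substTy (child A i r) (child A i tr) ts x p
  substTy r tr ts x (i ∷ p) | _ = substTy (child A i r) (child A i tr) ts x p

  substTy-root : ∀ r tr ts x → WellTypedAt r tr [] → ts [] ≡ type x →
                 substTy r tr ts x [] ≡ tr []
  substTy-root r tr ts x wr e with r [] in eq
  ... | just (var y) with y ≟Var x
  ...   | yes refl = trans e (sym (wr (var y) refl))
  ...   | no _     = refl
  substTy-root r tr ts x wr e | just (lam _)   = refl
  substTy-root r tr ts x wr e | just app       = refl
  substTy-root r tr ts x wr e | just (const _) = refl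
  substTy-root r tr ts x wr e | nothing        = refl

  subst-wellTypedAt-root : ∀ r tr s ts x → WellTyped r tr → WellTyped s ts →
                           ts [] ≡ type x → WellTypedAt (substAt A r s x) (substTy r tr ts x) []
  subst-wellTypedAt-root r tr s ts x wr ws e l le with r [] in eq
  ... | just (var y) with y ≟Var x
  ...   | yes refl = ws [] l le
  subst-wellTypedAt-root r tr s ts x wr ws e _ refl | just (var y) | no _ =
    wr [] (var y) eq
  subst-wellTypedAt-root r tr s ts x wr ws e _ refl | just (lam y) with y ≟Var x
  ... | yes _ = wr [] (lam y) eq
  ... | no _ rewrite substTy-root (child A 0 r) (child A 0 tr) ts x (wr (0 ∷ [])) e =
    wr [] (lam y) eq
  subst-wellTypedAt-root r tr s ts x wr ws e _ refl | just app
    rewrite substTy-root (child A 0 r) (child A 0 tr) ts x (wr (0 ∷ [])) e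
          | substTy-root (child A 1 r) (child A 1 tr) ts x (wr (1 ∷ [])) e =
    wr [] app eq
  subst-wellTypedAt-root r tr s ts x wr ws e _ refl | just (const g) = wr [] (const g) eq

  subst-wellTyped : ∀ r tr s ts x → WellTyped r tr → WellTyped s ts →
                    ts [] ≡ type x → WellTyped (substAt A r s x) (substTy r tr ts x)
  subst-wellTyped r tr s ts x wr ws e []      = subst-wellTypedAt-root r tr s ts x wr ws e
  subst-wellTyped r tr s ts x wr ws e (i ∷ q) with r []
  ... | just (var y) with y ≟Var x
  ...   | yes refl = ws (i ∷ q)
  ...   | no _     = wr (i ∷ q)
  subst-wellTyped r tr s ts x wr ws e (i ∷ q) | just (lam y) with y ≟Var x
  ... | yes _ = wr (i ∷ q)
  ... | no _  = subst-wellTyped (child A i r) (child A i tr) s ts x (child-wellTyped i wr) ws e q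
  subst-wellTyped r tr s ts x wr ws e (i ∷ q) | just app =
    subst-wellTyped (child A i r) (child A i tr) s ts x (child-wellTyped i wr) ws e q
  subst-wellTyped r tr s ts x wr ws e (i ∷ q) | just (const _) =
    subst-wellTyped (child A i r) (child A i tr) s ts x (child-wellTyped i wr) ws e q
  subst-wellTyped r tr s ts x wr ws e (i ∷ q) | nothing =
    subst-wellTyped (child A i r) (child A i tr) s ts x (child-wellTyped i wr) ws e q

  HasShape-cong : ∀ {u v} ws {f} → (∀ p → u p ≡ v p) → HasShape A u ws f → HasShape A v ws f
  HasShape-cong []       u≗v h        = trans (sym (u≗v [])) h
  HasShape-cong (_ ∷ ws) u≗v (h₀ , h) =
    trans (sym (u≗v [])) h₀ , HasShape-cong ws (λ p → u≗v (0 ∷ p)) h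

  cnAt-root-fn : ∀ t ts {f} → cnAt A t ts [] ≡ just (fn f) → t [] ≡ just (const f)
  cnAt-root-fn t ts h with t [] | h
  ... | just (const _) | refl = refl
  cnAt-root-fn t []      h | just (lam _) | ()
  cnAt-root-fn t (_ ∷ _) h | just (lam _) | ()

  cnAt-root-ℛ : ∀ t ts → cnAt A t ts [] ≡ just ℛ → t [] ≡ just app
  cnAt-root-ℛ t ts h with t [] | h
  ... | just app | refl = refl
  cnAt-root-ℛ t []      h | just (lam _) | ()
  cnAt-root-ℛ t (_ ∷ _) h | just (lam _) | ()

  cnAt-root-β : ∀ t ts → cnAt A t ts [] ≡ just β →
                Σ Var λ x → Σ (RawTm A) λ s → Σ (List (RawTm A)) λ ts′ →
                  t [] ≡ just (lam x) × ts ≡ s ∷ ts′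
  cnAt-root-β t ts h with t [] | h
  cnAt-root-β t (s ∷ ts′) h | just (lam x) | refl = x , s , ts′ , refl , refl

  cnAt-app-child : ∀ t ts → t [] ≡ just app →
                   ∀ p → cnAt A t ts (0 ∷ p) ≡ cnAt A (child A 0 t) (child A 1 t ∷ ts) p
  cnAt-app-child t ts eq p rewrite eq = refl

  cnAt-lam-child : ∀ t s ts {x} → t [] ≡ just (lam x) →
                   ∀ p → cnAt A t (s ∷ ts) (0 ∷ p) ≡ cnAt A (substAt A (child A 0 t) s x) ts p
  cnAt-lam-child t s ts eq p rewrite eq = refl

  cnAt-shape-balance : ∀ t ty → WellTyped t ty → ∀ ts → TypedArgs ts (ty []) →
                       ∀ ws f → HasShape A (cnAt A t ts) ws f →
                       length ts + countℛ ws ≡ countβ ws + ar A f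
  cnAt-shape-balance t ty wt ts wts [] f h = begin
    length ts + 0 ≡⟨ +-identityʳ (length ts) ⟩
    length ts     ≡⟨ length-typedArgs-arTy (ar A f) (subst (TypedArgs ts) ty-root wts) ⟩
    ar A f        ∎
    where
    open ≡-Reasoning
    ty-root : ty [] ≡ arTy (ar A f)
    ty-root = wt [] (const f) (cnAt-root-fn t ts h)
  cnAt-shape-balance t ty wt ts wts (Wℛ ∷ ws) f (h₀ , h) =
    trans (+-suc (length ts) (countℛ ws))
      (cnAt-shape-balance (child A 0 t) (child A 0 ty) (child-wellTyped 0 wt)
        (child A 1 t ∷ ts) wts′ ws f (HasShape-cong ws (cnAt-app-child t ts t-app) h))
    where
    t-app : t [] ≡ just app
    t-app = cnAt-root-ℛ t ts h₀
    wts′ : TypedArgs (child A 1 t ∷ ts) (ty (0 ∷ []))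
    wts′ = subst (TypedArgs (child A 1 t ∷ ts)) (sym (wt [] app t-app))
             ((child A 1 ty , child-wellTyped 1 wt , refl) ∷ₜ wts)
  cnAt-shape-balance t ty wt ts wts (Wβ ∷ ws) f (h₀ , h)
    with cnAt-root-β t ts h₀
  ... | x , s , ts′ , t-lam , refl
    with subst (TypedArgs (s ∷ ts′)) (wt [] (lam x) t-lam) wts
  ... | (tys , wt-s , tys-root) ∷ₜ wts′ =
    cong suc (cnAt-shape-balance r′ ty′ wt′ ts′ wts″ ws f
               (HasShape-cong ws (cnAt-lam-child t s ts′ t-lam) h))
    where
    r′ : RawTm A
    r′ = substAt A (child A 0 t) s x
    ty′ : Pos → Ty
    ty′ = substTy (child A 0 t) (child A 0 ty) tys x
    wt′ : WellTyped r′ ty′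
    wt′ = subst-wellTyped (child A 0 t) (child A 0 ty) s tys x (child-wellTyped 0 wt) wt-s tys-root
    wts″ : TypedArgs ts′ (ty′ [])
    wts″ = subst (TypedArgs ts′)
             (sym (substTy-root (child A 0 t) (child A 0 ty) tys x (wt (0 ∷ [])) tys-root)) wts′

lemma5p4 : (A : RankedAlphabet) {τ : Ty} (t : ClosedTm A τ) (ts : Args A τ)
           (ws : List (W A)) (f : Letter A) →
           HasShape A (cn A t ts) ws f →
           argsLength A ts + countℛ ws ≡ countβ ws + ar A f
lemma5p4 A t ts ws f h =
  subst (λ k → k + countℛ ws ≡ countβ ws + ar A f) (length-argsRaw A ts)
    (cnAt-shape-balance A (lab t) (ty t) (typed t) (argsRaw A ts)
      (subst (TypedArgs A (argsRaw A ts)) (sym (root t)) (typedArgs A ts)) ws f h)
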